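{- Let $a$ be an odd positive integer and $m$ a positive integer. For every positive integer $n$, $$t(a,3a,8m;n)=\frac 23N(a,3a,8m;8n+4a+8m)-2N(a,3a,8m;2n+a+2m).$$
   Context: For positive integers $a_1,\dots,a_k$ and a nonnegative integer $n$, $N(a_1,\dots,a_k;n)$ is the number of $(x_1,\dots,x_k)\in\mathbb Z^k$ with $n=a_1x_1^2+\cdots+a_kx_k^2$, and $t(a_1,\dots,a_k;n)$ is the number of $(x_1,\dots,x_k)\in\mathbb Z^k$ with $n=a_1\frac{x_1(x_1-1)}2+\cdots+a_k\frac{x_k(x_k-1)}2$. -}

module Defs where

open import Data.Nat using (ℕ; zero; suc; _+_; _*_; _≟_)
open import Data.Integer as ℤ using (ℤ; +_; -[1+_])
open import Data.List using (List; []; _∷_; length; filter; map; concatMap; upTo)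
open import Data.Integer.Base using (∣_∣)

range : ℕ → List ℤ
range B = map (λ i → ℤ.- (+ i)) (upTo (suc B)) Data.List.++ map (λ i → + suc i) (upTo B)
  where import Data.List

tuples : ℕ → ℕ → List (List ℤ)
tuples B zero = [] ∷ []
tuples B (suc k) = concatMap (λ x → map (x ∷_) (tuples B k)) (range B)

-- weighted sum a₁ f(x₁) + ⋯ + a_k f(x_k); (missing entries count as 0)
wsum : (ℤ → ℤ) → List ℕ → List ℤ → ℤ
wsum f (a ∷ as) (x ∷ xs) = (+ a) ℤ.* f x ℤ.+ wsum f as xs
wsum f _ _ = + 0

sq : ℤ → ℤ
sq x = x ℤ.* x

-- x(x-1)/2, computed as |x(x-1)|/2 (x(x-1) is always a nonnegative even integer)
tri : ℤ → ℤ
tri x = + (∣ x ℤ.* (x ℤ.- + 1) ∣ Data.Nat./ 2)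
  where import Data.Nat

countIn : (ℤ → ℤ) → ℕ → List ℕ → ℕ → ℕ
countIn f B as n = length (filter (λ xs → wsum f as xs ℤ.≟ + n) (tuples B (length as)))

-- N(a₁,…,a_k; n): number of (x₁,…,x_k) ∈ ℤ^k with n = a₁x₁²+⋯+a_kx_k².
-- For positive aᵢ every solution has |xᵢ| ≤ n, so searching [-n,n]^k counts all of them.
N : List ℕ → ℕ → ℕ
N as n = countIn sq n as n

-- t(a₁,…,a_k; n): number of (x₁,…,x_k) ∈ ℤ^k with n = a₁x₁(x₁-1)/2+⋯+a_kx_k(x_k-1)/2.
-- For positive aᵢ every solution has xᵢ(xᵢ-1)/2 ≤ n, hence |xᵢ| ≤ n+1.
t : List ℕ → ℕ → ℕ
t as n = countIn tri (suc n) as n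

{-# OPTIONS --safe #-}
module Submission where

-- Write Q = a x² + 3a y² + 8m z² and r = 2n + a + 2m, so that 8n + 4a + 8m = 4r.  As a is odd, every
-- solution of Q = 4r has x ≡ y (mod 2); split these solutions by the parities of x and z.  Those with
-- x, y, z all even are the doubles of the solutions of Q = r, and those with x, y, z all odd are the
-- points (2x−1, 2y−1, 2z−1) for the solutions counted by t(a,3a,8m; n).  For either parity of z there are
-- twice as many solutions with x odd as with x even: on Q′ = a u² + 3a v² + 2m z² = r, the maps
-- (u, v, z) ↦ (2u, 2v, z) and (u, v, z) ↦ (u + 3v, u − v, z) are bijections onto the solutions with x even
-- and (as r is odd) onto those with x odd and x ≡ y (mod 4), and y ↦ −y exchanges the latter with those
-- having x ≢ y (mod 4).  Hence, with E = N(a,3a,8m; r) and O the number of solutions of Q = 4r with x even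
-- and z odd, N(a,3a,8m; 4r) = 3E + 3O and t(a,3a,8m; n) = 2O.

open import Defs
open import Data.List using (_∷_; [])
open import Data.Integer as ℤ using (ℤ; +_)
open import Relation.Binary.PropositionalEquality using (_≡_)
open import Relation.Nullary using (¬_)

module Enumerations where

  open import Level using (0ℓ)
  open import Data.Nat using (ℕ; suc; _+_)
  open import Data.Nat.Properties using (+-suc)
  open import Data.List using (List; length; filter; map)
  open import Data.List.Properties using (length-map)
  open import Data.List.Membership.Propositional using (_∈_)
  open import Data.List.Membership.Propositional.Properties using (∈-filter⁺; ∈-filter⁻; ∈-map⁺; ∈-map⁻)
  open import Data.List.Membership.Propositional.Properties.WithK using (unique∧set⇒bag)
  open import Data.List.Relation.Binary.BagAndSetEquality using (∼bag⇒↭)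
  open import Data.List.Relation.Binary.Permutation.Propositional.Properties using (↭-length)
  open import Data.List.Relation.Unary.All as All using (All; []; _∷_)
  import Data.List.Relation.Unary.All.Properties as Allₚ
  open import Data.List.Relation.Unary.AllPairs using ([]; _∷_)
  open import Data.List.Relation.Unary.Unique.Propositional using (Unique)
  import Data.List.Relation.Unary.Unique.Propositional.Properties as Unique
  open import Data.Product using (∃; _×_; _,_)
  open import Function using (_∘_)
  open import Function.Bundles using (mk⇔)
  open import Relation.Nullary using (yes; no)
  open import Relation.Unary using (Pred; Decidable; _∩_)
  open import Relation.Unary.Properties using (∁?)
  open import Relation.Binary.PropositionalEquality using (refl; sym; trans; cong; subst)

  record Enumeration {A : Set} (P : Pred A 0ℓ) : Set where
    field
      elements : List A
      unique   : Unique elements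
      sound    : ∀ {x} → x ∈ elements → P x
      complete : ∀ {x} → P x → x ∈ elements

    size : ℕ
    size = length elements

  open Enumeration public

  record Bijection {A B : Set} (P : Pred A 0ℓ) (Q : Pred B 0ℓ) : Set where
    field
      to         : A → B
      to-∈       : ∀ {x} → P x → Q (to x)
      injective  : ∀ {x y} → P x → P y → to x ≡ to y → x ≡ y
      surjective : ∀ {y} → Q y → ∃ λ x → P x × to x ≡ y

  module _ {A : Set} {P : Pred A 0ℓ} where

    size-unique : (e₁ e₂ : Enumeration P) → size e₁ ≡ size e₂
    size-unique e₁ e₂ = ↭-length (∼bag⇒↭ (unique∧set⇒bag (unique e₁) (unique e₂)
      (mk⇔ (complete e₂ ∘ sound e₁) (complete e₁ ∘ sound e₂))))

    restrict : {Q : Pred A 0ℓ} → Decidable Q → Enumeration P → Enumeration (P ∩ Q)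
    restrict Q? e = record
      { elements = filter Q? (elements e)
      ; unique   = Unique.filter⁺ Q? (unique e)
      ; sound    = λ x∈ → let x∈e , Qx = ∈-filter⁻ Q? x∈ in sound e x∈e , Qx
      ; complete = λ (Px , Qx) → ∈-filter⁺ Q? (complete e Px) Qx
      }

    size-split : {Q : Pred A 0ℓ} (Q? : Decidable Q) (e : Enumeration P) →
                 size e ≡ size (restrict Q? e) + size (restrict (∁? Q?) e)
    size-split Q? e = length-split (elements e)
      where
      length-split : ∀ xs → length xs ≡ length (filter Q? xs) + length (filter (∁? Q?) xs)
      length-split []       = refl
      length-split (x ∷ xs) with Q? x
      ... | yes _ = cong suc (length-split xs)
      ... | no  _ = trans (cong suc (length-split xs)) (sym (+-suc _ _))

  module _ {A B : Set} {P : Pred A 0ℓ} {Q : Pred B 0ℓ} where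

    image : Bijection P Q → Enumeration P → Enumeration Q
    image b e = record
      { elements = map to (elements e)
      ; unique   = map-unique (All.tabulate (sound e)) (unique e)
      ; sound    = λ y∈ → let x , x∈ , y≡ = ∈-map⁻ to y∈ in subst Q (sym y≡) (to-∈ (sound e x∈))
      ; complete = λ Qy → let x , Px , x↦y = surjective Qy in
                          subst (_∈ map to (elements e)) x↦y (∈-map⁺ to (complete e Px))
      }
      where
      open Bijection b
      map-unique : ∀ {xs} → All P xs → Unique xs → Unique (map to xs)
      map-unique []         []           = []
      map-unique (Px ∷ Pxs) (x∉xs ∷ xs!) =
        Allₚ.map⁺ (All.zipWith (λ (x≢y , Py) → x≢y ∘ injective Px Py) (x∉xs , Pxs)) ∷ map-unique Pxs xs!

    size-image : (b : Bijection P Q) (e : Enumeration P) → size (image b e) ≡ size e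
    size-image b e = length-map (Bijection.to b) (elements e)

    bijection⇒size≡ : Bijection P Q → (e₁ : Enumeration P) (e₂ : Enumeration Q) → size e₁ ≡ size e₂
    bijection⇒size≡ b e₁ e₂ = trans (sym (size-image b e₁)) (size-unique (image b e₁) e₂)

module Triangular where

  open import Data.Nat using (ℕ; zero; suc; _+_; _*_; _/_; _≤_; z≤n; s≤s)
  open import Data.Nat.Properties
    using (*-comm; *-distribʳ-+; +-identityʳ; m≤m+n; n≤1+n; ≤-refl; ≤-reflexive; ≤-trans)
  open import Data.Nat.DivMod using (m*n/n≡m)
  open import Data.Nat.Tactic.RingSolver using (solve-∀)
  open import Data.Integer using (-[1+_]; ∣_∣)
  open import Data.Integer.Properties using (pos-*)
  open import Data.Product using (∃; _×_; _,_)
  open import Relation.Binary.PropositionalEquality using (refl; sym; trans; cong; module ≡-Reasoning)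
  open ≡-Reasoning

  triangular : ℕ → ℕ
  triangular zero    = zero
  triangular (suc k) = suc k + triangular k

  k≤triangular : ∀ k → k ≤ triangular k
  k≤triangular zero    = z≤n
  k≤triangular (suc k) = m≤m+n (suc k) (triangular k)

  pronic-suc : ∀ k → suc k * suc (suc k) ≡ suc k * 2 + k * suc k
  pronic-suc = solve-∀

  pronic≡triangular*2 : ∀ k → k * suc k ≡ triangular k * 2
  pronic≡triangular*2 zero    = refl
  pronic≡triangular*2 (suc k) = begin
    suc k * suc (suc k)           ≡⟨ pronic-suc k ⟩
    suc k * 2 + k * suc k         ≡⟨ cong (λ w → suc k * 2 + w) (pronic≡triangular*2 k) ⟩
    suc k * 2 + triangular k * 2  ≡⟨ *-distribʳ-+ 2 (suc k) (triangular k) ⟨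
    triangular (suc k) * 2        ∎

  pronic-form : ∀ x → ∃ λ k → x ℤ.* (x ℤ.- + 1) ≡ + (k * suc k) × ∣ x ∣ ≤ suc k
  pronic-form (+ zero)  = 0 , refl , z≤n
  pronic-form (+ suc j) = j , trans (sym (pos-* (suc j) j)) (cong +_ (*-comm (suc j) j)) , ≤-refl
  pronic-form -[1+ j ]  = suc j , cong (λ i → -[1+ j ] ℤ.* -[1+ suc i ]) (+-identityʳ j) , n≤1+n (suc j)

  tri≡triangular : ∀ x k → x ℤ.* (x ℤ.- + 1) ≡ + (k * suc k) → tri x ≡ + triangular k
  tri≡triangular x k x[x-1]≡ = begin
    + (∣ x ℤ.* (x ℤ.- + 1) ∣ / 2)  ≡⟨ cong (λ w → + (∣ w ∣ / 2)) x[x-1]≡ ⟩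
    + (k * suc k / 2)              ≡⟨ cong (λ w → + (w / 2)) (pronic≡triangular*2 k) ⟩
    + (triangular k * 2 / 2)       ≡⟨ cong +_ (m*n/n≡m (triangular k) 2) ⟩
    + triangular k                 ∎

  x[x-1]≡2*tri : ∀ x → x ℤ.* (x ℤ.- + 1) ≡ + 2 ℤ.* tri x
  x[x-1]≡2*tri x with k , x[x-1]≡ , _ ← pronic-form x = begin
    x ℤ.* (x ℤ.- + 1)       ≡⟨ x[x-1]≡ ⟩
    + (k * suc k)           ≡⟨ cong +_ (trans (pronic≡triangular*2 k) (*-comm (triangular k) 2)) ⟩
    + (2 * triangular k)    ≡⟨ pos-* 2 (triangular k) ⟩
    + 2 ℤ.* + triangular k  ≡⟨ cong (+ 2 ℤ.*_) (tri≡triangular x k x[x-1]≡) ⟨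
    + 2 ℤ.* tri x           ∎

  ∣x∣≤1+tri : ∀ x → ∣ x ∣ ≤ 1 + ∣ tri x ∣
  ∣x∣≤1+tri x with k , x[x-1]≡ , ∣x∣≤1+k ← pronic-form x =
    ≤-trans ∣x∣≤1+k (s≤s (≤-trans (k≤triangular k) (≤-reflexive (sym (cong ∣_∣ (tri≡triangular x k x[x-1]≡))))))

module BoundedSearch where

  open Enumerations
  open Bijection
  open import Level using (0ℓ)
  open import Data.Nat as ℕ using (ℕ; zero; suc; NonZero; z≤n; s≤s)
  open import Data.Nat.Properties as ℕ using (≤-trans; +-monoʳ-≤)
  open import Data.Integer using (-[1+_]; -_; _+_; _*_; _≟_; ∣_∣; _≤_)
  open import Data.Integer.Properties
    using (+-injective; neg-injective; ∣-i∣≡∣i∣; 0≤i⇒+∣i∣≡i; pos-+; pos-*; +-assoc; +-identityʳ)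
  open import Data.List using (List; length; map; upTo; concatMap; cartesianProductWith; _++_)
  open import Data.List.Properties using (∷-injective)
  open import Data.List.Membership.Propositional using (_∈_)
  open import Data.List.Membership.Propositional.Properties
    using (∈-map⁺; ∈-map⁻; ∈-++⁺ˡ; ∈-++⁺ʳ; ∈-++⁻; ∈-upTo⁺; ∈-upTo⁻; ∈-cartesianProductWith⁺; ∈-cartesianProductWith⁻)
  open import Data.List.Relation.Unary.All using (All; []; _∷_)
  open import Data.List.Relation.Unary.AllPairs using ([]; _∷_)
  open import Data.List.Relation.Unary.Any using (here)
  open import Data.List.Relation.Unary.Unique.Propositional using (Unique)
  import Data.List.Relation.Unary.Unique.Propositional.Properties as Unique
  open import Data.Product using (_×_; _,_)
  open import Data.Sum using (inj₁; inj₂)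
  open import Function using (_∘_)
  open import Relation.Unary using (Pred; _∩_)
  open import Relation.Binary.PropositionalEquality
    using (_≢_; refl; sym; trans; cong; cong₂; subst; module ≡-Reasoning)
  open ≡-Reasoning

  Triple : Set
  Triple = ℤ × ℤ × ℤ

  weighted : (ℤ → ℤ) → Triple → Triple → ℤ
  weighted f (α , β , γ) (x , y , z) = α * f x + β * f y + γ * f z

  Rep : (Triple → ℤ) → ℤ → Pred Triple 0ℓ
  Rep F k v = F v ≡ k

  Bounded : ℕ → Pred ℤ 0ℓ
  Bounded B x = ∣ x ∣ ℕ.≤ B

  range-enumeration : ∀ B → Enumeration (Bounded B)
  range-enumeration B = record
    { elements = range B
    ; unique   = Unique.++⁺ (Unique.map⁺ (+-injective ∘ neg-injective) (Unique.upTo⁺ (suc B)))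
                            (Unique.map⁺ (ℕ.suc-injective ∘ +-injective) (Unique.upTo⁺ B))
                            disjoint
    ; sound    = sound′
    ; complete = complete′
    }
    where
    -i≢+suc : ∀ i j → - (+ i) ≢ + suc j
    -i≢+suc zero    _ ()
    -i≢+suc (suc _) _ ()
    disjoint : ∀ {x} → ¬ (x ∈ map (λ i → - (+ i)) (upTo (suc B)) × x ∈ map (λ i → + suc i) (upTo B))
    disjoint (x∈₁ , x∈₂) with ∈-map⁻ (λ i → - (+ i)) {xs = upTo (suc B)} x∈₁ | ∈-map⁻ (λ i → + suc i) x∈₂
    ... | i , _ , x≡-i | j , _ , x≡1+j = -i≢+suc i j (trans (sym x≡-i) x≡1+j)
    sound′ : ∀ {x} → x ∈ range B → Bounded B x
    sound′ x∈ with ∈-++⁻ (map (λ i → - (+ i)) (upTo (suc B))) x∈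
    ... | inj₁ x∈₁ with i , i∈ , refl ← ∈-map⁻ _ x∈₁ =
      subst (ℕ._≤ B) (sym (∣-i∣≡∣i∣ (+ i))) (ℕ.s≤s⁻¹ (∈-upTo⁻ i∈))
    ... | inj₂ x∈₂ with j , j∈ , refl ← ∈-map⁻ _ x∈₂ = ∈-upTo⁻ j∈
    complete′ : ∀ {x} → Bounded B x → x ∈ range B
    complete′ {+ zero}    _     = ∈-++⁺ˡ (∈-map⁺ (λ i → - (+ i)) {x = 0} (∈-upTo⁺ {n = suc B} (s≤s z≤n)))
    complete′ {+ suc j}   1+j≤B = ∈-++⁺ʳ _ (∈-map⁺ (λ i → + suc i) (∈-upTo⁺ 1+j≤B))
    complete′ { -[1+ j ]} 1+j≤B = ∈-++⁺ˡ (∈-map⁺ (λ i → - (+ i)) {x = suc j} (∈-upTo⁺ {n = suc B} (s≤s 1+j≤B)))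

  concatMap≡cartesianProductWith : ∀ {A B C : Set} (f : A → B → C) xs ys →
                                   concatMap (λ x → map (f x) ys) xs ≡ cartesianProductWith f xs ys
  concatMap≡cartesianProductWith f []       ys = refl
  concatMap≡cartesianProductWith f (x ∷ xs) ys = cong (map (f x) ys ++_) (concatMap≡cartesianProductWith f xs ys)

  Tuple : ℕ → ℕ → Pred (List ℤ) 0ℓ
  Tuple B k xs = length xs ≡ k × All (Bounded B) xs

  module _ (B : ℕ) where

    private
      R = range-enumeration B

      tuples-suc : ∀ k → tuples B (suc k) ≡ cartesianProductWith _∷_ (range B) (tuples B k)
      tuples-suc k = concatMap≡cartesianProductWith _∷_ (range B) (tuples B k)

    tuples-unique : ∀ k → Unique (tuples B k)
    tuples-unique zero    = [] ∷ []
    tuples-unique (suc k) = subst Unique (sym (tuples-suc k))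
      (Unique.cartesianProductWith⁺ _∷_ ∷-injective (unique R) (tuples-unique k))

    tuples-sound : ∀ k {xs} → xs ∈ tuples B k → Tuple B k xs
    tuples-sound zero    (here refl) = refl , []
    tuples-sound (suc k) xs∈
      with _ , ys , x∈ , ys∈ , refl ←
             ∈-cartesianProductWith⁻ _∷_ (range B) (tuples B k) (subst (_ ∈_) (tuples-suc k) xs∈)
      with length≡ , ys-bounded ← tuples-sound k ys∈
      = cong suc length≡ , sound R x∈ ∷ ys-bounded

    tuples-complete : ∀ k {xs} → Tuple B k xs → xs ∈ tuples B k
    tuples-complete zero    {[]}     _                                    = here refl
    tuples-complete (suc k) {x ∷ ys} (length≡ , x-bounded ∷ ys-bounded) = subst (_ ∈_) (sym (tuples-suc k))
      (∈-cartesianProductWith⁺ _∷_ (complete R x-bounded) (tuples-complete k (ℕ.suc-injective length≡ , ys-bounded)))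

    tuples-enumeration : ∀ k → Enumeration (Tuple B k)
    tuples-enumeration k = record
      { elements = tuples B k
      ; unique   = tuples-unique k
      ; sound    = tuples-sound k
      ; complete = tuples-complete k
      }

  toList₃ : Triple → List ℤ
  toList₃ (x , y , z) = x ∷ y ∷ z ∷ []

  fromList₃ : List ℤ → Triple
  fromList₃ (x ∷ y ∷ z ∷ []) = x , y , z
  fromList₃ _                = + 0 , + 0 , + 0

  toList₃∘fromList₃ : ∀ {xs} → length xs ≡ 3 → toList₃ (fromList₃ xs) ≡ xs
  toList₃∘fromList₃ {_ ∷ _ ∷ _ ∷ []} refl = refl

  wsum≡weighted : ∀ f α β γ v → wsum f (α ∷ β ∷ γ ∷ []) (toList₃ v) ≡ weighted f (+ α , + β , + γ) v
  wsum≡weighted f α β γ (x , y , z) = begin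
    + α * f x + (+ β * f y + (+ γ * f z + + 0))  ≡⟨ cong (λ w → + α * f x + (+ β * f y + w)) (+-identityʳ _) ⟩
    + α * f x + (+ β * f y + + γ * f z)          ≡⟨ +-assoc (+ α * f x) _ _ ⟨
    + α * f x + + β * f y + + γ * f z            ∎

  weighted-cong : ∀ {f g} → (∀ x → f x ≡ g x) → ∀ W v → weighted f W v ≡ weighted g W v
  weighted-cong f≗g (α , β , γ) (x , y , z) =
    cong₂ _+_ (cong₂ (λ p q → α * p + β * q) (f≗g x) (f≗g y)) (cong (γ *_) (f≗g z))

  pos-weighted : ∀ α β γ p q r → + α * + p + + β * + q + + γ * + r ≡ + (α ℕ.* p ℕ.+ β ℕ.* q ℕ.+ γ ℕ.* r)
  pos-weighted α β γ p q r = begin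
    + α * + p + + β * + q + + γ * + r        ≡⟨ cong₂ _+_ (cong₂ _+_ (pos-* α p) (pos-* β q)) (pos-* γ r) ⟨
    + (α ℕ.* p) + + (β ℕ.* q) + + (γ ℕ.* r)  ≡⟨ cong (_+ + (γ ℕ.* r)) (pos-+ (α ℕ.* p) _) ⟨
    + (α ℕ.* p ℕ.+ β ℕ.* q) + + (γ ℕ.* r)    ≡⟨ pos-+ (α ℕ.* p ℕ.+ β ℕ.* q) _ ⟨
    + (α ℕ.* p ℕ.+ β ℕ.* q ℕ.+ γ ℕ.* r)      ∎

  summands≤ : ∀ α β γ p q r .{{_ : NonZero α}} .{{_ : NonZero β}} .{{_ : NonZero γ}} →
              let s = α ℕ.* p ℕ.+ β ℕ.* q ℕ.+ γ ℕ.* r in p ℕ.≤ s × q ℕ.≤ s × r ℕ.≤ s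
  summands≤ α β γ p q r =
      ≤-trans (ℕ.m≤n*m p α) (≤-trans (ℕ.m≤m+n (α ℕ.* p) (β ℕ.* q)) (ℕ.m≤m+n _ (γ ℕ.* r)))
    , ≤-trans (ℕ.m≤n*m q β) (≤-trans (ℕ.m≤n+m (β ℕ.* q) (α ℕ.* p)) (ℕ.m≤m+n _ (γ ℕ.* r)))
    , ≤-trans (ℕ.m≤n*m r γ) (ℕ.m≤n+m (γ ℕ.* r) (α ℕ.* p ℕ.+ β ℕ.* q))

  module _ (f : ℤ → ℤ) (c : ℕ) (f≥0 : ∀ x → + 0 ≤ f x) (f-bound : ∀ x → ∣ x ∣ ℕ.≤ c ℕ.+ ∣ f x ∣)
           (α β γ : ℕ) .{{_ : NonZero α}} .{{_ : NonZero β}} .{{_ : NonZero γ}} (k : ℕ) where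

    private
      weights : Triple
      weights = + α , + β , + γ

      B : ℕ
      B = c ℕ.+ k

      Solution : Pred (List ℤ) 0ℓ
      Solution xs = wsum f (α ∷ β ∷ γ ∷ []) xs ≡ + k

    weighted≡+sum : ∀ x y z →
      weighted f weights (x , y , z) ≡ + (α ℕ.* ∣ f x ∣ ℕ.+ β ℕ.* ∣ f y ∣ ℕ.+ γ ℕ.* ∣ f z ∣)
    weighted≡+sum x y z = trans (weighted-cong (λ w → sym (0≤i⇒+∣i∣≡i (f≥0 w))) weights (x , y , z))
                                (pos-weighted α β γ _ _ _)

    solution-bounded : ∀ {v} → weighted f weights v ≡ + k → All (Bounded B) (toList₃ v)
    solution-bounded {x , y , z} v≡k
      with fx≤k , fy≤k , fz≤k ← subst (λ s → ∣ f x ∣ ℕ.≤ s × ∣ f y ∣ ℕ.≤ s × ∣ f z ∣ ℕ.≤ s)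
                                      (+-injective (trans (sym (weighted≡+sum x y z)) v≡k)) (summands≤ α β γ _ _ _)
      = bound x fx≤k ∷ bound y fy≤k ∷ bound z fz≤k ∷ []
      where
      bound : ∀ w → ∣ f w ∣ ℕ.≤ k → Bounded B w
      bound w fw≤k = ≤-trans (f-bound w) (+-monoʳ-≤ c fw≤k)

    fromList₃-bijection : Bijection (Tuple B 3 ∩ Solution) (Rep (weighted f weights) (+ k))
    fromList₃-bijection .to = fromList₃
    fromList₃-bijection .to-∈ {xs} ((length≡3 , _) , xs≡k) = begin
      weighted f weights (fromList₃ xs)
        ≡⟨ wsum≡weighted f α β γ (fromList₃ xs) ⟨
      wsum f (α ∷ β ∷ γ ∷ []) (toList₃ (fromList₃ xs))
        ≡⟨ cong (wsum f (α ∷ β ∷ γ ∷ [])) (toList₃∘fromList₃ {xs} length≡3) ⟩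
      wsum f (α ∷ β ∷ γ ∷ []) xs
        ≡⟨ xs≡k ⟩
      + k
        ∎
    fromList₃-bijection .injective ((length≡3 , _) , _) ((length′≡3 , _) , _) eq =
      trans (sym (toList₃∘fromList₃ length≡3)) (trans (cong toList₃ eq) (toList₃∘fromList₃ length′≡3))
    fromList₃-bijection .surjective {v} v≡k =
      toList₃ v , ((refl , solution-bounded v≡k) , trans (wsum≡weighted f α β γ v) v≡k) , refl

    private
      tuple-solutions : Enumeration (Tuple B 3 ∩ Solution)
      tuple-solutions = restrict (λ xs → wsum f (α ∷ β ∷ γ ∷ []) xs ≟ + k) (tuples-enumeration B 3)

    countIn-enumeration : Enumeration (Rep (weighted f weights) (+ k))
    countIn-enumeration = image fromList₃-bijection tuple-solutions

    size-countIn-enumeration : size countIn-enumeration ≡ countIn f B (α ∷ β ∷ γ ∷ []) k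
    size-countIn-enumeration = size-image fromList₃-bijection tuple-solutions

module Parity where

  open import Level using (0ℓ)
  open import Data.Nat using (suc; s≤s)
  import Data.Nat.Divisibility as ℕ using (_∣_; ∣1⇒≡1)
  open import Data.Nat.Primality using (prime?; euclidsLemma)
  open import Data.Integer using (_+_; _-_; _*_)
  open import Data.Integer.Properties using (abs-*; +-identityˡ; +-comm)
  open import Data.Integer.DivMod using (_%ℕ_; _/ℕ_; n%ℕd<d; a≡a%ℕn+[a/ℕn]*n)
  open import Data.Integer.Divisibility.Signed
    using (_∣_; _∣?_; divides; ∣⇒∣ᵤ; ∣ᵤ⇒∣; ∣m∣n⇒∣m+n; ∣m+n∣m⇒∣n; *-cancelʳ-∣)
  open import Data.Integer.Tactic.RingSolver using (solve-∀)
  open import Data.Product using (∃; _,_)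
  open import Data.Sum as Sum using (_⊎_; inj₁; inj₂)
  open import Data.Empty using (⊥-elim)
  open import Relation.Nullary using (yes; no)
  open import Relation.Nullary.Decidable using (from-yes)
  open import Relation.Unary using (Pred; Decidable)
  open import Relation.Binary.PropositionalEquality using (refl; trans; cong; subst; module ≡-Reasoning)
  open ≡-Reasoning

  Even : Pred ℤ 0ℓ
  Even x = + 2 ∣ x

  even? : Decidable Even
  even? x = + 2 ∣? x

  ¬even-1 : ¬ Even (+ 1)
  ¬even-1 2∣1 with () ← ℕ.∣1⇒≡1 (∣⇒∣ᵤ 2∣1)

  ¬even-2k+1 : ∀ k → ¬ Even (k * + 2 + + 1)
  ¬even-2k+1 k 2∣2k+1 = ¬even-1 (∣m+n∣m⇒∣n 2∣2k+1 (divides k refl))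

  odd⇒2k+1 : ∀ {x} → ¬ Even x → ∃ λ k → x ≡ k * + 2 + + 1
  odd⇒2k+1 {x} x-odd with x %ℕ 2 | n%ℕd<d x 2 | a≡a%ℕn+[a/ℕn]*n x 2
  ... | 0           | _            | x≡ = ⊥-elim (x-odd (divides (x /ℕ 2) (trans x≡ (+-identityˡ _))))
  ... | 1           | _            | x≡ = x /ℕ 2 , trans x≡ (+-comm (+ 1) ((x /ℕ 2) * + 2))
  ... | suc (suc _) | s≤s (s≤s ()) | _

  even-*⁻ : ∀ {x y} → Even (x * y) → Even x ⊎ Even y
  even-*⁻ {x} {y} 2∣xy = Sum.map ∣ᵤ⇒∣ ∣ᵤ⇒∣
    (euclidsLemma ℤ.∣ x ∣ ℤ.∣ y ∣ (from-yes (prime? 2)) (subst (2 ℕ.∣_) (abs-* x y) (∣⇒∣ᵤ 2∣xy)))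

  private
    odd-difference : ∀ k l → (k * + 2 + + 1) - (l * + 2 + + 1) ≡ (k - l) * + 2
    odd-difference = solve-∀

    difference+sum : ∀ x y → (x - y) + (x + y) ≡ x * + 2
    difference+sum = solve-∀

    sum-via-difference : ∀ x y → x + y ≡ (x - y) + y * + 2
    sum-via-difference = solve-∀

    double-double : ∀ e → e * + 2 * + 2 ≡ e * + 4
    double-double = solve-∀

    odd-double-sum : ∀ j l → (j * + 2 + + 1) * + 2 + (l * + 2 + + 1) * + 2 ≡ (j + l + + 1) * + 4
    odd-double-sum = solve-∀

  odd-odd⇒even : ∀ {x y} → ¬ Even x → ¬ Even y → Even (x - y)
  odd-odd⇒even x-odd y-odd with k , refl ← odd⇒2k+1 x-odd | l , refl ← odd⇒2k+1 y-odd =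
    divides (k - l) (odd-difference k l)

  4∣x-y⇒4∤x+y : ∀ {x y} → ¬ Even x → + 4 ∣ x - y → ¬ + 4 ∣ x + y
  4∣x-y⇒4∤x+y {x} {y} x-odd 4∣x-y 4∣x+y =
    x-odd (*-cancelʳ-∣ (+ 2) (subst (+ 4 ∣_) (difference+sum x y) (∣m∣n⇒∣m+n 4∣x-y 4∣x+y)))

  4∣x-y⊎4∣x+y : ∀ {x y} → ¬ Even x → ¬ Even y → + 4 ∣ x - y ⊎ + 4 ∣ x + y
  4∣x-y⊎4∣x+y {x} {y} x-odd y-odd with divides d x-y≡2d ← odd-odd⇒even x-odd y-odd | even? d
  ... | yes (divides e refl) = inj₁ (divides e (trans x-y≡2d (double-double e)))
  ... | no d-odd with j , refl ← odd⇒2k+1 d-odd | l , refl ← odd⇒2k+1 y-odd = inj₂ (divides (j + l + + 1) (begin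
    x + (l * + 2 + + 1)                            ≡⟨ sum-via-difference x _ ⟩
    (x - (l * + 2 + + 1)) + (l * + 2 + + 1) * + 2  ≡⟨ cong (_+ (l * + 2 + + 1) * + 2) x-y≡2d ⟩
    (j * + 2 + + 1) * + 2 + (l * + 2 + + 1) * + 2  ≡⟨ odd-double-sum j l ⟩
    (j + l + + 1) * + 4                            ∎))

-- Stated with the forms Q, Q′ of Representations unfolded: solve-∀ does not unfold definitions.
module PolynomialIdentities where

  open import Data.Integer using (-_; _+_; _-_; _*_)
  open import Data.Integer.Tactic.RingSolver using (solve-∀)

  Q-square-of-sum : ∀ a m x y z →
    a * ((x + y) * (x + y))
      ≡ (a * (x * x) + (+ 3 * a) * (y * y) + (+ 8 * m) * (z * z)) - (a * (y * y) - a * x * y + + 4 * m * (z * z)) * + 2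
  Q-square-of-sum = solve-∀

  Q′-square-of-sum : ∀ a m u v z →
    a * (u * u) + (+ 3 * a) * (v * v) + (+ 2 * m) * (z * z)
      ≡ a * ((u + v) * (u + v)) + (a * (v * v) - a * u * v + m * (z * z)) * + 2
  Q′-square-of-sum = solve-∀

  u+3v≡u+v+2v : ∀ u v → u + + 3 * v ≡ (u + v) + v * + 2
  u+3v≡u+v+2v = solve-∀

  Q-rotate : ∀ a m u v z →
    a * ((u + + 3 * v) * (u + + 3 * v)) + (+ 3 * a) * ((u - v) * (u - v)) + (+ 8 * m) * (z * z)
      ≡ + 4 * (a * (u * u) + (+ 3 * a) * (v * v) + (+ 2 * m) * (z * z))
  Q-rotate = solve-∀

  rotate-difference : ∀ u v → (u + + 3 * v) - (u - v) ≡ v * + 4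
  rotate-difference = solve-∀

  rotate-preimage : ∀ y q → (y + q) + + 3 * q ≡ q * + 4 + y
  rotate-preimage = solve-∀

  subtract-add : ∀ x y → (x - y) + y ≡ x
  subtract-add = solve-∀

  add-subtract : ∀ x y → (x + y) - y ≡ x
  add-subtract = solve-∀

  Q-double-xy : ∀ a m u v z →
    a * ((u * + 2) * (u * + 2)) + (+ 3 * a) * ((v * + 2) * (v * + 2)) + (+ 8 * m) * (z * z)
      ≡ + 4 * (a * (u * u) + (+ 3 * a) * (v * v) + (+ 2 * m) * (z * z))
  Q-double-xy = solve-∀

  Q-double : ∀ a m u v w →
    a * ((u * + 2) * (u * + 2)) + (+ 3 * a) * ((v * + 2) * (v * + 2)) + (+ 8 * m) * ((w * + 2) * (w * + 2))
      ≡ + 4 * (a * (u * u) + (+ 3 * a) * (v * v) + (+ 8 * m) * (w * w))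
  Q-double = solve-∀

  Q-negate-y : ∀ a m x y z →
    a * (x * x) + (+ 3 * a) * (- y * - y) + (+ 8 * m) * (z * z)
      ≡ a * (x * x) + (+ 3 * a) * (y * y) + (+ 8 * m) * (z * z)
  Q-negate-y = solve-∀

  Q-odd-shift : ∀ a m x y z →
    a * ((x * + 2 - + 1) * (x * + 2 - + 1)) + (+ 3 * a) * ((y * + 2 - + 1) * (y * + 2 - + 1))
      + (+ 8 * m) * ((z * + 2 - + 1) * (z * + 2 - + 1))
      ≡ + 4 * (a * (x * (x - + 1)) + (+ 3 * a) * (y * (y - + 1)) + (+ 8 * m) * (z * (z - + 1)) + a + + 2 * m)
  Q-odd-shift = solve-∀

  weighted-double : ∀ α β γ p q s → α * (+ 2 * p) + β * (+ 2 * q) + γ * (+ 2 * s) ≡ + 2 * (α * p + β * q + γ * s)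
  weighted-double = solve-∀

  2x-1≡2[x-1]+1 : ∀ x → x * + 2 - + 1 ≡ (x - + 1) * + 2 + + 1
  2x-1≡2[x-1]+1 = solve-∀

  2[k+1]-1≡2k+1 : ∀ k → (k + + 1) * + 2 - + 1 ≡ k * + 2 + + 1
  2[k+1]-1≡2k+1 = solve-∀

  2n+a+2m≡a+2[n+m] : ∀ a m n → + 2 * n + a + + 2 * m ≡ a + (n + m) * + 2
  2n+a+2m≡a+2[n+m] = solve-∀

open Parity using (Even)

module Representations (a m : ℤ) (a-odd : ¬ Even a) where

  open Enumerations
  open Bijection
  open Triangular using (x[x-1]≡2*tri)
  open BoundedSearch using (Triple; weighted; Rep; weighted-cong)
  open Parity
  open PolynomialIdentities
  open import Level using (0ℓ)
  open import Data.Integer using (-_; _+_; _-_; _*_)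
  open import Data.Integer.Properties
    using (*-cancelˡ-≡; *-cancelʳ-≡; neg-injective; neg-involutive; +-0-abelianGroup)
  open import Algebra.Properties.AbelianGroup +-0-abelianGroup using () renaming (∙-cancelʳ to +-cancelʳ-≡)
  open import Data.Integer.Divisibility.Signed
    using (_∣_; _∣?_; divides; ∣m∣n⇒∣m-n; ∣m∣n⇒∣m+n; ∣m+n∣m⇒∣n; ∣m+n∣n⇒∣m; ∣n⇒∣m*n; ∣m⇒∣m*n)
  open import Data.Product using (_,_; proj₁; proj₂)
  open import Data.Sum using ([_,_]′; reduce)
  open import Data.Empty using (⊥-elim)
  open import Function using (_∘_)
  open import Relation.Unary using (Pred; Decidable; _∩_; ∁)
  open import Relation.Binary.PropositionalEquality using (refl; sym; trans; cong; cong₂; subst; module ≡-Reasoning)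
  open ≡-Reasoning

  weights : Triple
  weights = a , + 3 * a , + 8 * m

  Q Q′ T : Triple → ℤ
  Q  = weighted sq  weights
  Q′ = weighted sq  (a , + 3 * a , + 2 * m)
  T  = weighted tri weights

  x+y-even : ∀ x y z → Even (Q (x , y , z)) → Even (x + y)
  x+y-even x y z 2∣Q = [ ⊥-elim ∘ a-odd , reduce ∘ even-*⁻ ]′ (even-*⁻ 2∣a[x+y]²)
    where
    2∣a[x+y]² : Even (a * ((x + y) * (x + y)))
    2∣a[x+y]² = subst Even (sym (Q-square-of-sum a m x y z))
                  (∣m∣n⇒∣m-n 2∣Q (divides (a * (y * y) - a * x * y + + 4 * m * (z * z)) refl))

  even-x⇒even-y : ∀ x y z → Even (Q (x , y , z)) → Even x → Even y
  even-x⇒even-y x y z 2∣Q = ∣m+n∣m⇒∣n (x+y-even x y z 2∣Q)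

  odd-x⇒odd-y : ∀ x y z → Even (Q (x , y , z)) → ¬ Even x → ¬ Even y
  odd-x⇒odd-y x y z 2∣Q x-odd 2∣y = x-odd (∣m+n∣n⇒∣m (x+y-even x y z 2∣Q) 2∣y)

  u+3v-odd : ∀ u v z → ¬ Even (Q′ (u , v , z)) → ¬ Even (u + + 3 * v)
  u+3v-odd u v z Q′-odd 2∣u+3v =
    Q′-odd (subst Even (sym (Q′-square-of-sum a m u v z))
      (∣m∣n⇒∣m+n (∣n⇒∣m*n a (∣m⇒∣m*n (u + v) 2∣u+v)) (divides (a * (v * v) - a * u * v + m * (z * z)) refl)))
    where
    2∣u+v : Even (u + v)
    2∣u+v = ∣m+n∣n⇒∣m (subst Even (u+3v≡u+v+2v u v) 2∣u+3v) (divides v refl)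

  ≡4r⇒even : ∀ {k} r → k ≡ + 4 * r → Even k
  ≡4r⇒even r k≡4r = subst Even (sym k≡4r) (∣m⇒∣m*n r (divides (+ 2) refl))

  target : ℤ → ℤ
  target n = + 2 * n + a + + 2 * m

  target-odd : ∀ n → ¬ Even (target n)
  target-odd n 2∣target =
    a-odd (∣m+n∣n⇒∣m (subst Even (2n+a+2m≡a+2[n+m] a m n) 2∣target) (divides (n + m) refl))

  target-injective : ∀ {k n} → target k ≡ target n → k ≡ n
  target-injective {k} {n} eq = *-cancelˡ-≡ (+ 2) k n (+-cancelʳ-≡ a _ _ (+-cancelʳ-≡ (+ 2 * m) _ _ eq))

  x-[-y]≡x+y : ∀ x y → x - - y ≡ x + y
  x-[-y]≡x+y x y = cong (_+_ x) (neg-involutive y)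

  EvenX : Pred Triple 0ℓ
  EvenX (x , _ , _) = Even x

  evenX? : Decidable EvenX
  evenX? (x , _ , _) = even? x

  OnZ : Pred ℤ 0ℓ → Pred Triple 0ℓ
  OnZ R (_ , _ , z) = R z

  onZ? : ∀ {R} → Decidable R → Decidable (OnZ R)
  onZ? R? (_ , _ , z) = R? z

  Congruent₄ : Pred Triple 0ℓ
  Congruent₄ (x , y , _) = + 4 ∣ x - y

  congruent₄? : Decidable Congruent₄
  congruent₄? (x , y , _) = + 4 ∣? (x - y)

  EvenPart OddPart : ℤ → Pred ℤ 0ℓ → Pred Triple 0ℓ
  EvenPart r R = (Rep Q (+ 4 * r) ∩ EvenX) ∩ OnZ R
  OddPart  r R = (Rep Q (+ 4 * r) ∩ ∁ EvenX) ∩ OnZ R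

  map₃ : (ℤ → ℤ) → Triple → Triple
  map₃ f (x , y , z) = f x , f y , f z

  ≡-triple : ∀ {x y z x′ y′ z′ : ℤ} → x ≡ x′ → y ≡ y′ → z ≡ z′ → (x , y , z) ≡ (x′ , y′ , z′)
  ≡-triple x≡ y≡ z≡ = cong₂ _,_ x≡ (cong₂ _,_ y≡ z≡)

  map₃-injective : ∀ {f} → (∀ {x y} → f x ≡ f y → x ≡ y) → ∀ v w → map₃ f v ≡ map₃ f w → v ≡ w
  map₃-injective f-injective _ _ eq =
    ≡-triple (f-injective (cong proj₁ eq)) (f-injective (cong (proj₁ ∘ proj₂) eq))
             (f-injective (cong (proj₂ ∘ proj₂) eq))

  module _ (r : ℤ) (R : Pred ℤ 0ℓ) where

    Halves : Pred Triple 0ℓ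
    Halves = Rep Q′ r ∩ OnZ R

    double-xy : Bijection Halves (EvenPart r R)
    double-xy .to (u , v , z) = u * + 2 , v * + 2 , z
    double-xy .to-∈ {u , v , z} (Q′≡r , Rz) =
      (trans (Q-double-xy a m u v z) (cong (+ 4 *_) Q′≡r) , divides u refl) , Rz
    double-xy .injective {u , v , z} {u′ , v′ , z′} _ _ eq =
      ≡-triple (*-cancelʳ-≡ u u′ (+ 2) (cong proj₁ eq)) (*-cancelʳ-≡ v v′ (+ 2) (cong (proj₁ ∘ proj₂) eq))
               (cong (proj₂ ∘ proj₂) eq)
    double-xy .surjective {x , y , z} ((Q≡4r , 2∣x@(divides u x≡2u)) , Rz) =
      (u , v , z) , (Q′≡r , Rz) , image≡
      where
      open _∣_ (even-x⇒even-y x y z (≡4r⇒even r Q≡4r) 2∣x) renaming (quotient to v; equality to y≡2v)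
      image≡ : (u * + 2 , v * + 2 , z) ≡ (x , y , z)
      image≡ = ≡-triple (sym x≡2u) (sym y≡2v) refl
      Q′≡r : Q′ (u , v , z) ≡ r
      Q′≡r = *-cancelˡ-≡ (+ 4) _ _ (trans (sym (Q-double-xy a m u v z)) (trans (cong Q image≡) Q≡4r))

    rotate : ¬ Even r → Bijection Halves (OddPart r R ∩ Congruent₄)
    rotate r-odd .to (u , v , z) = u + + 3 * v , u - v , z
    rotate r-odd .to-∈ {u , v , z} (Q′≡r , Rz) =
      ((trans (Q-rotate a m u v z) (cong (+ 4 *_) Q′≡r) , u+3v-odd u v z (subst (¬_ ∘ Even) (sym Q′≡r) r-odd)) , Rz)
      , divides v (rotate-difference u v)
    rotate r-odd .injective {u , v , z} {u′ , v′ , z′} _ _ eq = ≡-triple u≡u′ v≡v′ (cong (proj₂ ∘ proj₂) eq)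
      where
      x≡ : u + + 3 * v ≡ u′ + + 3 * v′
      x≡ = cong proj₁ eq
      y≡ : u - v ≡ u′ - v′
      y≡ = cong (proj₁ ∘ proj₂) eq
      v≡v′ : v ≡ v′
      v≡v′ = *-cancelʳ-≡ v v′ (+ 4) (begin
        v * + 4                      ≡⟨ rotate-difference u v ⟨
        (u + + 3 * v) - (u - v)      ≡⟨ cong₂ _-_ x≡ y≡ ⟩
        (u′ + + 3 * v′) - (u′ - v′)  ≡⟨ rotate-difference u′ v′ ⟩
        v′ * + 4                     ∎)
      u≡u′ : u ≡ u′
      u≡u′ = begin
        u               ≡⟨ subtract-add u v ⟨
        (u - v) + v     ≡⟨ cong₂ _+_ y≡ v≡v′ ⟩
        (u′ - v′) + v′  ≡⟨ subtract-add u′ v′ ⟩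
        u′              ∎
    rotate r-odd .surjective {x , y , z} (((Q≡4r , _) , Rz) , divides q x-y≡4q) =
      (y + q , q , z) , (Q′≡r , Rz) , image≡
      where
      image≡ : (y + q + + 3 * q , (y + q) - q , z) ≡ (x , y , z)
      image≡ = cong₂ _,_ (begin
        (y + q) + + 3 * q  ≡⟨ rotate-preimage y q ⟩
        q * + 4 + y        ≡⟨ cong (_+ y) x-y≡4q ⟨
        (x - y) + y        ≡⟨ subtract-add x y ⟩
        x                  ∎) (cong₂ _,_ (add-subtract y q) refl)
      Q′≡r : Q′ (y + q , q , z) ≡ r
      Q′≡r = *-cancelˡ-≡ (+ 4) _ _ (begin
        + 4 * Q′ (y + q , q , z)                  ≡⟨ Q-rotate a m (y + q) q z ⟨
        Q (y + q + + 3 * q , (y + q) - q , z)     ≡⟨ cong Q image≡ ⟩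
        Q (x , y , z)                             ≡⟨ Q≡4r ⟩
        + 4 * r                                   ∎)

    negate-y : Bijection (OddPart r R ∩ Congruent₄) (OddPart r R ∩ ∁ Congruent₄)
    negate-y .to (x , y , z) = x , - y , z
    negate-y .to-∈ {x , y , z} (((Q≡4r , x-odd) , Rz) , 4∣x-y) =
      ((trans (Q-negate-y a m x y z) Q≡4r , x-odd) , Rz) , 4∣x-y⇒4∤x+y x-odd 4∣x-y ∘ subst (+ 4 ∣_) (x-[-y]≡x+y x y)
    negate-y .injective _ _ eq =
      ≡-triple (cong proj₁ eq) (neg-injective (cong (proj₁ ∘ proj₂) eq)) (cong (proj₂ ∘ proj₂) eq)
    negate-y .surjective {x , y , z} (((Q≡4r , x-odd) , Rz) , 4∤x-y) =
      (x , - y , z) , (((trans (Q-negate-y a m x y z) Q≡4r , x-odd) , Rz) , 4∣x-[-y])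
      , cong (λ y′ → x , y′ , z) (neg-involutive y)
      where
      4∣x-[-y] : + 4 ∣ x - - y
      4∣x-[-y] = [ ⊥-elim ∘ 4∤x-y , subst (+ 4 ∣_) (sym (x-[-y]≡x+y x y)) ]′
                 (4∣x-y⊎4∣x+y x-odd (odd-x⇒odd-y x y z (≡4r⇒even r Q≡4r) x-odd))

  double : ∀ r → Bijection (Rep Q r) (EvenPart r Even)
  double r .to = map₃ (_* + 2)
  double r .to-∈ {u , v , w} Q≡r =
    (trans (Q-double a m u v w) (cong (+ 4 *_) Q≡r) , divides u refl) , divides w refl
  double r .injective {v} {w} _ _ = map₃-injective (λ {x} {y} → *-cancelʳ-≡ x y (+ 2)) v w
  double r .surjective {x , y , z} ((Q≡4r , 2∣x@(divides u x≡2u)) , divides w z≡2w) =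
    (u , v , w) , Q≡r , image≡
    where
    open _∣_ (even-x⇒even-y x y z (≡4r⇒even r Q≡4r) 2∣x) renaming (quotient to v; equality to y≡2v)
    image≡ : map₃ (_* + 2) (u , v , w) ≡ (x , y , z)
    image≡ = ≡-triple (sym x≡2u) (sym y≡2v) (sym z≡2w)
    Q≡r : Q (u , v , w) ≡ r
    Q≡r = *-cancelˡ-≡ (+ 4) _ _ (trans (sym (Q-double a m u v w)) (trans (cong Q image≡) Q≡4r))

  odd : ℤ → ℤ
  odd x = x * + 2 - + 1

  odd-odd : ∀ x → ¬ Even (odd x)
  odd-odd x = subst (¬_ ∘ Even) (sym (2x-1≡2[x-1]+1 x)) (¬even-2k+1 (x - + 1))

  odd-preimage : ∀ {x} → ¬ Even x → ℤ
  odd-preimage x-odd = proj₁ (odd⇒2k+1 x-odd) + + 1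

  odd-preimage-spec : ∀ {x} (x-odd : ¬ Even x) → odd (odd-preimage x-odd) ≡ x
  odd-preimage-spec x-odd = trans (2[k+1]-1≡2k+1 (proj₁ (odd⇒2k+1 x-odd))) (sym (proj₂ (odd⇒2k+1 x-odd)))

  odd-injective : ∀ {x y} → odd x ≡ odd y → x ≡ y
  odd-injective {x} {y} eq = *-cancelʳ-≡ x y (+ 2) (+-cancelʳ-≡ (- + 1) (x * + 2) (y * + 2) eq)

  Q∘odd : ∀ v → Q (map₃ odd v) ≡ + 4 * (+ 2 * T v + a + + 2 * m)
  Q∘odd v@(x , y , z) = begin
    Q (map₃ odd v)                                                  ≡⟨ Q-odd-shift a m x y z ⟩
    + 4 * (weighted (λ w → w * (w - + 1)) weights v + a + + 2 * m)  ≡⟨ cong (λ s → + 4 * (s + a + + 2 * m)) pronic-sum ⟩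
    + 4 * (+ 2 * T v + a + + 2 * m)                                 ∎
    where
    pronic-sum : weighted (λ w → w * (w - + 1)) weights v ≡ + 2 * T v
    pronic-sum = trans (weighted-cong x[x-1]≡2*tri weights v)
                       (weighted-double a (+ 3 * a) (+ 8 * m) (tri x) (tri y) (tri z))

  odd-shift : ∀ n → Bijection (Rep T n) (OddPart (target n) (∁ Even))
  odd-shift n .to = map₃ odd
  odd-shift n .to-∈ {x , y , z} T≡n =
    (trans (Q∘odd (x , y , z)) (cong (λ t → + 4 * (+ 2 * t + a + + 2 * m)) T≡n) , odd-odd x) , odd-odd z
  odd-shift n .injective {v} {w} _ _ = map₃-injective odd-injective v w
  odd-shift n .surjective {x , y , z} ((Q≡4target , x-odd) , z-odd) =
    (x′ , y′ , z′) , T≡n , image≡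
    where
    x′ y′ z′ : ℤ
    x′ = odd-preimage x-odd
    y′ = odd-preimage (odd-x⇒odd-y x y z (≡4r⇒even (target n) Q≡4target) x-odd)
    z′ = odd-preimage z-odd
    image≡ : map₃ odd (x′ , y′ , z′) ≡ (x , y , z)
    image≡ = ≡-triple (odd-preimage-spec x-odd) (odd-preimage-spec _) (odd-preimage-spec z-odd)
    T≡n : T (x′ , y′ , z′) ≡ n
    T≡n = target-injective
      (*-cancelˡ-≡ (+ 4) _ _ (trans (sym (Q∘odd (x′ , y′ , z′))) (trans (cong Q image≡) Q≡4target)))

module Counting (a m : ℤ) (a-odd : ¬ Even a) where

  open Enumerations
  open BoundedSearch using (Rep)
  open Parity using (even?)
  open Representations a m a-odd
  open import Data.Nat using (ℕ; _+_; _*_)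
  open import Data.Nat.Properties using (+-identityʳ)
  open import Data.Nat.Tactic.RingSolver using (solve-∀)
  open import Relation.Unary using (Decidable; _∩_; ∁)
  open import Relation.Unary.Properties using (∁?)
  open import Relation.Binary.PropositionalEquality using (sym; trans; cong; cong₂; module ≡-Reasoning)
  open ≡-Reasoning

  size-OddPart≡2*size-EvenPart : ∀ {r R} → ¬ Even r → (R? : Decidable R)
    (S : Enumeration (Rep Q (+ 4 ℤ.* r))) → Enumeration (Rep Q′ r) →
    size (restrict (onZ? R?) (restrict (∁? evenX?) S)) ≡ 2 * size (restrict (onZ? R?) (restrict evenX? S))
  size-OddPart≡2*size-EvenPart {r} {R} r-odd R? S D = begin
    size A             ≡⟨ size-split congruent₄? A ⟩
    size A⁺ + size A⁻  ≡⟨ cong (_+_ (size A⁺)) (bijection⇒size≡ (negate-y r R) A⁺ A⁻) ⟨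
    size A⁺ + size A⁺  ≡⟨ cong₂ _+_ D≡A⁺ D≡A⁺ ⟨
    size D′ + size D′  ≡⟨ cong₂ _+_ D≡C (trans D≡C (sym (+-identityʳ (size C)))) ⟩
    2 * size C         ∎
    where
    A : Enumeration (OddPart r R)
    A = restrict (onZ? R?) (restrict (∁? evenX?) S)
    C : Enumeration (EvenPart r R)
    C = restrict (onZ? R?) (restrict evenX? S)
    D′ : Enumeration (Halves r R)
    D′ = restrict (onZ? R?) D
    A⁺ : Enumeration (OddPart r R ∩ Congruent₄)
    A⁺ = restrict congruent₄? A
    A⁻ : Enumeration (OddPart r R ∩ ∁ Congruent₄)
    A⁻ = restrict (∁? congruent₄?) A
    D≡A⁺ : size D′ ≡ size A⁺
    D≡A⁺ = bijection⇒size≡ (rotate r R r-odd) D′ A⁺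
    D≡C : size D′ ≡ size C
    D≡C = bijection⇒size≡ (double-xy r R) D′ C

  counting-arithmetic : ∀ e c → 3 * (2 * c) + 6 * e ≡ 2 * (e + c + (2 * e + 2 * c))
  counting-arithmetic = solve-∀

  counting : ∀ n (S : Enumeration (Rep Q (+ 4 ℤ.* target n))) (S′ : Enumeration (Rep Q (target n)))
             → Enumeration (Rep Q′ (target n)) → (Tn : Enumeration (Rep T n))
             → 3 * size Tn + 6 * size S′ ≡ 2 * size S
  counting n S S′ D Tn = begin
    3 * size Tn + 6 * size S′          ≡⟨ cong₂ (λ t s′ → 3 * t + 6 * s′) Tn≡2cO S′≡cE ⟩
    3 * (2 * cO) + 6 * cE              ≡⟨ counting-arithmetic cE cO ⟩
    2 * (cE + cO + (2 * cE + 2 * cO))  ≡⟨ cong (2 *_) S≡ ⟨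
    2 * size S                         ∎
    where
    EvenPartₑ : ∀ {R} → Decidable R → Enumeration (EvenPart (target n) R)
    EvenPartₑ R? = restrict (onZ? R?) (restrict evenX? S)
    OddPartₑ : ∀ {R} → Decidable R → Enumeration (OddPart (target n) R)
    OddPartₑ R? = restrict (onZ? R?) (restrict (∁? evenX?) S)
    cE cO : ℕ
    cE = size (EvenPartₑ even?)
    cO = size (EvenPartₑ (∁? even?))
    OddPart≡2*EvenPart : ∀ {R} (R? : Decidable R) → size (OddPartₑ R?) ≡ 2 * size (EvenPartₑ R?)
    OddPart≡2*EvenPart R? = size-OddPart≡2*size-EvenPart (target-odd n) R? S D
    S≡ : size S ≡ cE + cO + (2 * cE + 2 * cO)
    S≡ = begin
      size S
        ≡⟨ size-split evenX? S ⟩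
      size (restrict evenX? S) + size (restrict (∁? evenX?) S)
        ≡⟨ cong₂ _+_ (size-split (onZ? even?) (restrict evenX? S))
                     (size-split (onZ? even?) (restrict (∁? evenX?) S)) ⟩
      cE + cO + (size (OddPartₑ even?) + size (OddPartₑ (∁? even?)))
        ≡⟨ cong (_+_ (cE + cO)) (cong₂ _+_ (OddPart≡2*EvenPart even?) (OddPart≡2*EvenPart (∁? even?))) ⟩
      cE + cO + (2 * cE + 2 * cO)
        ∎
    Tn≡2cO : size Tn ≡ 2 * cO
    Tn≡2cO = trans (bijection⇒size≡ (odd-shift n) Tn (OddPartₑ (∁? even?))) (OddPart≡2*EvenPart (∁? even?))
    S′≡cE : size S′ ≡ cE
    S′≡cE = bijection⇒size≡ (double (target n)) S′ (EvenPartₑ even?)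

open import Data.Nat using (ℕ; zero; suc; _+_; _*_; _≤_; z≤n; NonZero)
open import Data.Nat.Divisibility using (_∣_)
open import Data.Nat.Properties using (m≤m*n; m*n≢0)
open import Data.Nat.Tactic.RingSolver using (solve-∀)
open import Data.Integer.Properties using (pos-+; pos-*)
open import Data.Integer.Divisibility.Signed using (∣⇒∣ᵤ)
open import Data.List using (List)
open import Data.Product using (Σ-syntax; _,_; proj₁; proj₂)
open import Function using (_∘_)
open import Relation.Binary.PropositionalEquality using (refl; sym; trans; cong; cong₂; subst; module ≡-Reasoning)
open ≡-Reasoning
open Enumerations using (Enumeration; size)
open BoundedSearch using (Triple; Rep; weighted; countIn-enumeration; size-countIn-enumeration)
open Triangular using (∣x∣≤1+tri)
open PolynomialIdentities using (add-subtract)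

sq≡∣x∣*∣x∣ : ∀ x → sq x ≡ + (ℤ.∣ x ∣ * ℤ.∣ x ∣)
sq≡∣x∣*∣x∣ (+ k)      = sym (pos-* k k)
sq≡∣x∣*∣x∣ ℤ.-[1+ k ] = refl

sq≥0 : ∀ x → + 0 ℤ.≤ sq x
sq≥0 x = subst (+ 0 ℤ.≤_) (sym (sq≡∣x∣*∣x∣ x)) (ℤ.+≤+ z≤n)

∣x∣≤∣sq∣ : ∀ x → ℤ.∣ x ∣ ≤ 0 + ℤ.∣ sq x ∣
∣x∣≤∣sq∣ x = subst (ℤ.∣ x ∣ ≤_) (cong ℤ.∣_∣ (sym (sq≡∣x∣*∣x∣ x))) (n≤n*n ℤ.∣ x ∣)
  where
  n≤n*n : ∀ n → n ≤ n * n
  n≤n*n zero    = z≤n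
  n≤n*n (suc n) = m≤m*n (suc n) (suc n)

representations : ∀ α β γ k .{{_ : NonZero α}} .{{_ : NonZero β}} .{{_ : NonZero γ}} {W K} →
  (+ α , + β , + γ) ≡ W → + k ≡ K →
  Σ[ e ∈ Enumeration (Rep (weighted sq W) K) ] size e ≡ N (α ∷ β ∷ γ ∷ []) k
representations α β γ k refl refl =
    countIn-enumeration sq 0 sq≥0 ∣x∣≤∣sq∣ α β γ k
  , size-countIn-enumeration sq 0 sq≥0 ∣x∣≤∣sq∣ α β γ k

triangular-representations : ∀ α β γ n .{{_ : NonZero α}} .{{_ : NonZero β}} .{{_ : NonZero γ}} {W} →
  (+ α , + β , + γ) ≡ W →
  Σ[ e ∈ Enumeration (Rep (weighted tri W) (+ n)) ] size e ≡ t (α ∷ β ∷ γ ∷ []) n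
triangular-representations α β γ n refl =
    countIn-enumeration tri 1 (λ _ → ℤ.+≤+ z≤n) ∣x∣≤1+tri α β γ n
  , size-countIn-enumeration tri 1 (λ _ → ℤ.+≤+ z≤n) ∣x∣≤1+tri α β γ n

8n+4a+8m≡4[2n+a+2m] : ∀ a m n → 8 * n + 4 * a + 8 * m ≡ 4 * (2 * n + a + 2 * m)
8n+4a+8m≡4[2n+a+2m] = solve-∀

pos-weights : ∀ a c m → _≡_ {A = Triple} (+ a , + (3 * a) , + (c * m)) (+ a , + 3 ℤ.* + a , + c ℤ.* + m)
pos-weights a c m = cong₂ (λ β γ → + a , β , γ) (pos-* 3 a) (pos-* c m)

pos-2n+a+2m : ∀ a m n → + (2 * n + a + 2 * m) ≡ + 2 ℤ.* + n ℤ.+ + a ℤ.+ + 2 ℤ.* + m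
pos-2n+a+2m a m n =
  trans (pos-+ (2 * n + a) (2 * m)) (cong₂ ℤ._+_ (trans (pos-+ (2 * n) a) (cong (ℤ._+ + a) (pos-* 2 n))) (pos-* 2 m))

pos-8n+4a+8m : ∀ a m n → + (8 * n + 4 * a + 8 * m) ≡ + 4 ℤ.* (+ 2 ℤ.* + n ℤ.+ + a ℤ.+ + 2 ℤ.* + m)
pos-8n+4a+8m a m n = trans (cong +_ (8n+4a+8m≡4[2n+a+2m] a m n))
                           (trans (pos-* 4 (2 * n + a + 2 * m)) (cong (+ 4 ℤ.*_) (pos-2n+a+2m a m n)))

3t+6N≡2N : (a m n : ℕ) → .{{NonZero a}} → ¬ (2 ∣ a) → .{{NonZero m}} →
  3 * t (a ∷ 3 * a ∷ 8 * m ∷ []) n + 6 * N (a ∷ 3 * a ∷ 8 * m ∷ []) (2 * n + a + 2 * m)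
    ≡ 2 * N (a ∷ 3 * a ∷ 8 * m ∷ []) (8 * n + 4 * a + 8 * m)
3t+6N≡2N a m n 2∤a = begin
  3 * t as n + 6 * N as M′
    ≡⟨ cong₂ (λ p q → 3 * p + 6 * q) (proj₂ Tₑ) (proj₂ S′ₑ) ⟨
  3 * size (proj₁ Tₑ) + 6 * size (proj₁ S′ₑ)
    ≡⟨ counting (+ n) (proj₁ Sₑ) (proj₁ S′ₑ) (proj₁ Dₑ) (proj₁ Tₑ) ⟩
  2 * size (proj₁ Sₑ)
    ≡⟨ cong (2 *_) (proj₂ Sₑ) ⟩
  2 * N as M
    ∎
  where
  a-odd : ¬ Even (+ a)
  a-odd = 2∤a ∘ ∣⇒∣ᵤ
  open Representations (+ a) (+ m) a-odd using (Q; Q′; T; target)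
  open Counting (+ a) (+ m) a-odd using (counting)
  as : List ℕ
  as = a ∷ 3 * a ∷ 8 * m ∷ []
  M M′ : ℕ
  M  = 8 * n + 4 * a + 8 * m
  M′ = 2 * n + a + 2 * m
  instance
    3a≢0 : NonZero (3 * a)
    3a≢0 = m*n≢0 3 a
    2m≢0 : NonZero (2 * m)
    2m≢0 = m*n≢0 2 m
    8m≢0 : NonZero (8 * m)
    8m≢0 = m*n≢0 8 m
  Sₑ : Σ[ e ∈ Enumeration (Rep Q (+ 4 ℤ.* target (+ n))) ] size e ≡ N as M
  Sₑ = representations a (3 * a) (8 * m) M (pos-weights a 8 m) (pos-8n+4a+8m a m n)
  S′ₑ : Σ[ e ∈ Enumeration (Rep Q (target (+ n))) ] size e ≡ N as M′
  S′ₑ = representations a (3 * a) (8 * m) M′ (pos-weights a 8 m) (pos-2n+a+2m a m n)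
  Dₑ : Σ[ e ∈ Enumeration (Rep Q′ (target (+ n))) ] size e ≡ N (a ∷ 3 * a ∷ 2 * m ∷ []) M′
  Dₑ = representations a (3 * a) (2 * m) M′ (pos-weights a 2 m) (pos-2n+a+2m a m n)
  Tₑ : Σ[ e ∈ Enumeration (Rep T (+ n)) ] size e ≡ t as n
  Tₑ = triangular-representations a (3 * a) (8 * m) n (pos-weights a 8 m)

+p≡+[p+q]-+q : ∀ p q → + p ≡ + (p + q) ℤ.- + q
+p≡+[p+q]-+q p q = trans (sym (add-subtract (+ p) (+ q))) (cong (ℤ._- + q) (sym (pos-+ p q)))

theorem3p2 : (a m n : ℕ) → .{{NonZero a}} → ¬ (2 ∣ a) → .{{NonZero m}} → .{{NonZero n}} →
    + 3 ℤ.* + t (a ∷ 3 * a ∷ 8 * m ∷ []) n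
    ≡ + 2 ℤ.* + N (a ∷ 3 * a ∷ 8 * m ∷ []) (8 * n + 4 * a + 8 * m)
    ℤ.- + 6 ℤ.* + N (a ∷ 3 * a ∷ 8 * m ∷ []) (2 * n + a + 2 * m)
theorem3p2 a m n 2∤a = begin
  + 3 ℤ.* + t as n
    ≡⟨ pos-* 3 (t as n) ⟨
  + (3 * t as n)
    ≡⟨ +p≡+[p+q]-+q (3 * t as n) (6 * N as M′) ⟩
  + (3 * t as n + 6 * N as M′) ℤ.- + (6 * N as M′)
    ≡⟨ cong₂ (λ p q → + p ℤ.- q) (3t+6N≡2N a m n 2∤a) (pos-* 6 (N as M′)) ⟩
  + (2 * N as M) ℤ.- + 6 ℤ.* + N as M′
    ≡⟨ cong (ℤ._- + 6 ℤ.* + N as M′) (pos-* 2 (N as M)) ⟩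
  + 2 ℤ.* + N as M ℤ.- + 6 ℤ.* + N as M′
    ∎
  where
  as : List ℕ
  as = a ∷ 3 * a ∷ 8 * m ∷ []
  M M′ : ℕ
  M  = 8 * n + 4 * a + 8 * m
  M′ = 2 * n + a + 2 * m
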